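{- Let $\gamma$ be an indecomposable permutation (i.e. a permutation with no global ascent). Then (1) the poset $P_\gamma$ is an indecomposable poset (i.e. it has no global split), and (2) for every permutation $\beta$ one has $\Psi_{\zeta_\gamma}(\beta)=\Psi_{\zeta_{P_\gamma}}(P_\beta)$; that is, $\Psi_{\zeta_\gamma}=\Psi_{\zeta_{P_\gamma}}\circ\varphi$ as maps $\mathcal S\to Sym$, where $\varphi$ is the linear map $\beta\mapsto P_\beta$.
   Context: Work over a field $\Bbbk$. Permutations. $\mathcal S=\bigoplus_{n\ge0}\mathcal S_n$, where $\mathcal S_n$ is the $\Bbbk$-span of the permutations of $[n]=\{1,\dots,n\}$ written as words $\alpha=\alpha(1)\cdots\alpha(n)$, and $\mathcal S_0$ is spanned by the empty permutation $\emptyset$. The product of $\alpha\in\mathcal S_a$ and $\beta\in\mathcal S_b$ is $\alpha\cdot\beta^{\uparrow a}=\alpha(1)\cdots\alpha(a)(\beta(1)+a)\cdots(\beta(b)+a)$, extended bilinearly; the unit is $\emptyset$. For $A\subseteq[n]$, $\alpha|_A$ is the subword of $\alpha$ formed by the letters lying in $A$, and $st$ (standardization) replaces the letters of a word with distinct letters by $1,2,\dots$ preserving their relative order. A global ascent of $\alpha\in\mathcal S_n$ is an $i$ with $1\le i\le n-1$ such that $\alpha(r)<\alpha(s)$ whenever $r\le i<s$. A permutation is indecomposable if it has no global ascent. $\mathcal S$ is a free associative algebra on the indecomposable permutations. For an indecomposable $\gamma$, let $\zeta_\gamma\colon\mathcal S\to\Bbbk$ be the unique algebra morphism with $\zeta_\gamma(\gamma)=1$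 and $\zeta_\gamma(\delta)=0$ for every other indecomposable permutation $\delta$. Posets. $\mathcal P=\bigoplus_n\mathcal P_n$, where $\mathcal P_n$ is the $\Bbbk$-span of all partial orders on $[n]$. For $P\in\mathcal P_a$ and $Q\in\mathcal P_b$, the product $P<Q^{\uparrow a}$ is the poset on $[a+b]$ whose order is that of $P$ on $\{1,\dots,a\}$, that of $Q$ shifted by $a$ on $\{a+1,\dots,a+b\}$, and $i<j$ whenever $i\le a<j$. For $A\subseteq[n]$, $P|_A$ is the induced order on $A$, and $st(P|_A)$ is its transport to $\{1,\dots,|A|\}$ via the order-preserving bijection. A global split of $P\in\mathcal P_n$ is an $i$ with $1\le i\le n-1$ such that $P=P|_{\{1,\dots,i\}}<P|_{\{i+1,\dots,n\}}$. A poset is indecomposable if it has no global split. $\mathcal P$ is a free associative algebra on the indecomposable posets. For an indecomposable poset $Q$, let $\zeta_Q\colon\mathcal P\to\Bbbk$ be the unique algebra morphism with $\zeta_Q(Q)=1$ and $\zeta_Q$ equal to $0$ on every other indecomposable poset. For a permutation $\alpha$ of $[n]$, $P_\alpha$ is the poset on $[n]$ with $i<_{P_\alpha}j$ if and only if $i<j$ and $\alpha(i)<\alpha(j)$. Invariants. For $H=\mathcal S$ or $\mathcal P$, a character $\zeta$, and $x$ a basis element of degree $n$ (a permutation or a poset on $[n]$), set $\Psi_\zeta(x)=\sum_{\alpha\models n}\Big(\sum_{(A_1,\dots,A_\ell)}\prod_{i=1}^{\ell}\zeta\big(st(x|_{A_i})\big)\Big)M_\alpha,$ where $\alpha=(\alpha_1,\dots,\alpha_\ell)$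 ranges over compositions of $n$, the inner sum is over ordered set partitions $(A_1,\dots,A_\ell)$ of $[n]$ with $|A_i|=\alpha_i$, and $M_\alpha=\sum_{i_1<\dots<i_\ell}x_{i_1}^{\alpha_1}\cdots x_{i_\ell}^{\alpha_\ell}$ is the monomial quasisymmetric function. Extend linearly. (This is the unique graded Hopf morphism $\Psi_\zeta\colon H\to QSym$ with $\zeta=\varphi_1\circ\Psi_\zeta$, where $\varphi_1(f)=f(1,0,0,\dots)$; its image lies in the symmetric functions $Sym$.) -}

module Defs where

open import Level using (Level; _⊔_)
open import Data.Bool using (Bool; true; false; _∧_; if_then_else_; not)
open import Data.Nat using (ℕ; zero; suc; _<_; _≤_; _<ᵇ_; _≡ᵇ_)
open import Data.Fin using (Fin; toℕ)
open import Data.Fin.Properties using () renaming (_≟_ to _≟ᶠ_)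
open import Data.List using (List; []; _∷_; map; filter; length; take; drop; upTo; lookup; foldr)
open import Data.List.Properties using (≡-dec)
open import Data.List.Relation.Unary.All using (All)
open import Data.List.Relation.Unary.Any using (any?)
open import Data.List.Base using (allFin)

allᵇ : ∀ {A : Set} → (A → Bool) → List A → Bool
allᵇ p = foldr (λ x b → p x ∧ b) true

open import Data.Bool.Properties using () renaming (_≟_ to _≟ᵇ_)
open import Data.Nat.Properties using () renaming (_≟_ to _≟ⁿ_)
open import Data.Maybe using (Maybe; just; nothing)
open import Data.Product using (Σ; _×_; _,_; ∃)
open import Data.Vec.Functional using () renaming (_∷_ to _∷ᶠ_)
open import Relation.Nullary using (¬_; Dec; yes; no; does)
open import Relation.Nullary.Decidable using (⌊_⌋)
open import Relation.Binary.PropositionalEquality using (_≡_)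
open import Data.Fin.Permutation using (Permutation′; _⟨$⟩ʳ_)
open import Data.Nat.ListAction using (sum)
open import Algebra.Bundles using (CommutativeRing)

IsField : ∀ {c ℓ} → CommutativeRing c ℓ → Set (c ⊔ ℓ)
IsField K = (¬ (1# ≈ 0#)) × (∀ x → ¬ (x ≈ 0#) → ∃ λ y → x * y ≈ 1#)
  where open CommutativeRing K

-- Permutations of [n] are elements of Permutation′ n (bijections Fin n ↔ Fin n);
-- positions and letters are 0-based (Fin n stands for [n] = {1..n}).

-- global ascent of α : an i with 1 ≤ i ≤ n-1 such that α(r) < α(s)
-- whenever r ≤ i < s (1-based), i.e. toℕ r < i ≤ toℕ s (0-based).
GlobalAscent : ∀ {n} → Permutation′ n → ℕ → Set
GlobalAscent {n} α i =
  1 ≤ i × i < n ×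
  (∀ (r s : Fin n) → toℕ r < i → i ≤ toℕ s → toℕ (α ⟨$⟩ʳ r) < toℕ (α ⟨$⟩ʳ s))

IndecomposablePerm : ∀ {n} → Permutation′ n → Set
IndecomposablePerm α = ∀ i → ¬ GlobalAscent α i

-- Posets on [n] are given by their strict order relation, as a Bool-valued
-- relation on Fin n.
FinPoset : ℕ → Set
FinPoset n = Fin n → Fin n → Bool

-- global split: P = P|{1..i} < P|{i+1..n}; the induced orders on both parts
-- agree automatically, so this says: every r in the lower part is below every
-- s in the upper part, and no s in the upper part is below an r in the lower part.
GlobalSplit : ∀ {n} → FinPoset n → ℕ → Set
GlobalSplit {n} P i =
  1 ≤ i × i < n ×
  (∀ (r s : Fin n) → toℕ r < i → i ≤ toℕ s → (P r s ≡ true) × (P s r ≡ false))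

IndecomposablePoset : ∀ {n} → FinPoset n → Set
IndecomposablePoset P = ∀ i → ¬ GlobalSplit P i

posetOf : ∀ {n} → Permutation′ n → FinPoset n
posetOf α i j = (toℕ i <ᵇ toℕ j) ∧ (toℕ (α ⟨$⟩ʳ i) <ᵇ toℕ (α ⟨$⟩ʳ j))

-- A word with distinct letters; standardization replaces each letter by
-- its rank (0-based) among the letters of the word.
st : List ℕ → List ℕ
st w = map (λ x → length (filter (λ y → y Data.Nat.<? x) w)) w

word : ∀ {n} → Permutation′ n → List ℕ
word {n} α = map (λ i → toℕ (α ⟨$⟩ʳ i)) (allFin n)

-- A standardized poset on [m] as an m×m Bool matrix (list of rows),
-- entry (a,b) = [a <_P b].  st(P|_A) for A given as an increasing list.
restrictPoset : ∀ {n} → FinPoset n → List (Fin n) → List (List Bool)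
restrictPoset P A = map (λ a → map (λ b → P a b) A) A

posetMatrix : ∀ {n} → FinPoset n → List (List Bool)
posetMatrix {n} P = restrictPoset P (allFin n)

isAscentᵇ : List ℕ → ℕ → Bool
isAscentᵇ w i = (1 Data.Nat.≤ᵇ i) ∧ (i <ᵇ length w) ∧
  allᵇ (λ a → allᵇ (λ b → a <ᵇ b) (drop i w)) (take i w)

entry : List (List Bool) → ℕ → ℕ → Bool
entry [] r s = false
entry (row ∷ M) zero s = go row s
  where go : List Bool → ℕ → Bool
        go [] _ = false
        go (x ∷ xs) zero = x
        go (x ∷ xs) (suc k) = go xs k
entry (row ∷ M) (suc r) s = entry M r s

submatrix : List (List Bool) → List ℕ → List (List Bool)
submatrix M A = map (λ a → map (λ b → entry M a b) A) A

isSplitᵇ : List (List Bool) → ℕ → Bool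
isSplitᵇ M i = (1 Data.Nat.≤ᵇ i) ∧ (i <ᵇ length M) ∧
  allᵇ (λ r → allᵇ (λ s → entry M r s ∧ not (entry M s r)) (drop i (upTo (length M))))
      (upTo i)

first : (ℕ → Bool) → List ℕ → Maybe ℕ
first p [] = nothing
first p (x ∷ xs) = if p x then just x else first p xs

-- Factorization into indecomposables: cut at the first global ascent and
-- recurse on the (standardized) rest.  The fuel (length) bounds the recursion.
factorsWord : ℕ → List ℕ → List (List ℕ)
factorsWord fuel [] = []
factorsWord zero w = w ∷ []
factorsWord (suc f) w with first (isAscentᵇ w) (upTo (length w))
... | nothing = st w ∷ []
... | just i = st (take i w) ∷ factorsWord f (st (drop i w))

factorsPoset : ℕ → List (List Bool) → List (List (List Bool))
factorsPoset fuel [] = []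
factorsPoset zero M = M ∷ []
factorsPoset (suc f) M with first (isSplitᵇ M) (upTo (length M))
... | nothing = M ∷ []
... | just i = submatrix M (upTo i)
             ∷ factorsPoset f (submatrix M (drop i (upTo (length M))))

module _ {c ℓ} (K : CommutativeRing c ℓ) where
  open CommutativeRing K

  prodL : List Carrier → Carrier
  prodL = foldr _*_ 1#

  sumFin : ∀ k → (Fin k → Carrier) → Carrier
  sumFin k g = foldr (λ j acc → g j + acc) 0# (allFin k)

  prodFin : ∀ k → (Fin k → Carrier) → Carrier
  prodFin k g = foldr (λ j acc → g j * acc) 1# (allFin k)

  sumFuns : ∀ n k → ((Fin n → Fin k) → Carrier) → Carrier
  sumFuns zero k F = F (λ ())
  sumFuns (suc n) k F = sumFin k (λ j → sumFuns n k (λ g → F (j ∷ᶠ g)))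

  -- ζ_γ : the algebra morphism S → K sending the indecomposable γ to 1 and
  -- every other indecomposable to 0, evaluated on a (standardized) word:
  -- the product over its indecomposable factors.
  ζPerm : List ℕ → List ℕ → Carrier
  ζPerm γ w = prodL (map (λ u → if ⌊ ≡-dec _≟ⁿ_ u γ ⌋ then 1# else 0#)
                         (factorsWord (length w) w))

  ζPoset : List (List Bool) → List (List Bool) → Carrier
  ζPoset Q M = prodL (map (λ u → if ⌊ ≡-dec (≡-dec _≟ᵇ_) u Q ⌋ then 1# else 0#)
                          (factorsPoset (length M) M))

-- st(β|_A): the subword of β formed by the letters lying in A, standardized
restrictWord : ∀ {n} → Permutation′ n → List (Fin n) → List ℕ
restrictWord {n} β A =
  st (map toℕ (filter (λ x → any? (λ a → a ≟ᶠ x) A) (map (β ⟨$⟩ʳ_) (allFin n))))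

Composition : ℕ → Set
Composition n = Σ (List ℕ) (λ α → All (1 ≤_) α × sum α ≡ n)

-- block A_j = f⁻¹(j) of the ordered set partition encoded by f : Fin n → Fin ℓ,
-- listed increasingly
block : ∀ {n ℓ} → (Fin n → Fin ℓ) → Fin ℓ → List (Fin n)
block {n} f j = filter (λ x → f x ≟ᶠ j) (allFin n)

hasSizes : ∀ {n} (α : List ℕ) → (Fin n → Fin (length α)) → Bool
hasSizes α f = allᵇ (λ j → length (block f j) ≡ᵇ lookup α j) (allFin (length α))

module _ {c ℓ} (K : CommutativeRing c ℓ) where
  open CommutativeRing K

  -- coefficient of M_α in Ψ_ζ(x), for a character ζ on standardized
  -- restrictions  restr A = st(x|_A).
  Ψcoeff : ∀ {n} {X : Set} → (X → Carrier) → (List (Fin n) → X) → Composition n → Carrier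
  Ψcoeff {n} ζ restr (α , _) =
    sumFuns K n (length α) (λ f →
      if hasSizes α f
      then prodFin K (length α) (λ j → ζ (restr (block f j)))
      else 0#)

  ΨPerm : ∀ {m n} → Permutation′ m → Permutation′ n → Composition n → Carrier
  ΨPerm γ β = Ψcoeff (ζPerm K (word γ)) (restrictWord β)

  ΨPoset : ∀ {m n} → FinPoset m → FinPoset n → Composition n → Carrier
  ΨPoset Q P = Ψcoeff (ζPoset K (posetMatrix Q)) (restrictPoset P)

-- A global split of P_γ is in particular a global ascent of γ, which gives (1).
-- For (2), the map w ↦ P_w on words with distinct letters turns global ascents
-- into global splits and commutes with standardization and with cutting a word
-- into an initial and a final segment; it is moreover injective on standardized
-- words. Hence it carries the factorization of a word into indecomposables onto
-- the factorization of its poset, and ζ_γ(u) = ζ_{P_γ}(P_u). In the coefficient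
-- of M_α in Ψ_{ζ_γ}(β) the blocks are sets A of letters, in that of
-- Ψ_{ζ_{P_γ}}(P_β) sets of positions; relabelling by β matches A with the
-- positions β⁻¹(A), and st(β|_A) is the standardized subword of β at those
-- positions, whose poset is P_β restricted to them. So both sums agree term by term.

module Submission where

open import Defs
open import Algebra.Bundles using (CommutativeRing)
import Algebra.Properties.CommutativeMonoid.Sum as CommutativeMonoidSum
open import Data.Bool using (Bool; true; false; _∧_; _∨_; not; if_then_else_)
open import Data.Bool.Properties using (∨-identityʳ; ∧-identityʳ) renaming (_≟_ to _≟ᵇ_)
open import Data.Empty using (⊥-elim)
open import Data.Fin using (Fin; zero; suc; toℕ; punchIn; punchOut)
open import Data.Fin.Permutation using (Permutation′; _⟨$⟩ʳ_; _⟨$⟩ˡ_; remove; inverseˡ; inverseʳ; punchIn-permute′)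
open import Data.Fin.Properties using (punchIn-punchOut; toℕ-injective; toℕ<n) renaming (_≟_ to _≟ᶠ_)
open import Data.List as List using (List; []; _∷_; map; filter; length; tabulate; allFin; take; drop; applyUpTo; upTo)
open import Data.List.Membership.Propositional using (_∈_)
open import Data.List.Membership.Propositional.Properties using (∈-filter⁺; ∈-filter⁻; ∈-allFin)
open import Data.List.Properties
  using (≡-dec; foldr-cong; map-∘; map-cong; map-cong-local; map-tabulate; length-take; length-drop; length-map; length-upTo)
open import Data.List.Relation.Unary.All as All using (All; []; _∷_)
open import Data.List.Relation.Unary.AllPairs using (AllPairs; []; _∷_)
import Data.List.Relation.Unary.AllPairs.Properties as APP
open import Data.List.Relation.Unary.Any as Any using (Any; any?; here; there)
open import Data.List.Relation.Unary.Unique.Propositional using (Unique)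
import Data.List.Relation.Unary.Unique.Propositional.Properties as UP
open import Data.Maybe using (Maybe; just; nothing)
open import Data.Nat using (ℕ; zero; suc; _+_; _∸_; _<_; _≤_; z≤n; s≤s; _<ᵇ_; _≤ᵇ_; _≡ᵇ_; _<?_)
open import Data.Nat.Properties
  using (+-0-commutativeMonoid; <-cmp; ≤-refl; ≤-trans; <-trans; <-≤-trans; <⇒≤; <⇒≢; m≤n+m; m≤m+n; m≤n⇒m⊓n≡m)
  renaming (_≟_ to _≟ⁿ_)
open import Data.Product using (_×_; _,_; ∃; proj₁; proj₂)
open import Data.Vec.Functional using (insertAt) renaming (_∷_ to _∷ᶠ_)
open import Data.Vec.Functional.Properties using (insertAt-lookup; insertAt-punchIn)
open import Function using (_∘_; id)
open import Function.Bundles using (_⇔_; mk⇔)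
open import Level using (0ℓ)
open import Relation.Binary using (tri<; tri≈; tri>)
open import Relation.Binary.PropositionalEquality using (_≡_; _≢_; _≗_; refl; sym; trans; cong; cong₂; subst; module ≡-Reasoning)
import Relation.Binary.Reasoning.Setoid as SetoidReasoning
open import Relation.Nullary using (Dec; yes; no; does)
open import Relation.Nullary.Decidable using (does-⇔; isYes≗does; ⌊_⌋)
open import Relation.Unary using (Pred; Decidable)

-- Pointwise equality and block sizes

≗-punchIn : ∀ {n} {A : Set} {f g : Fin (suc n) → A} (p : Fin (suc n)) →
  f p ≡ g p → (∀ y → f (punchIn p y) ≡ g (punchIn p y)) → f ≗ g
≗-punchIn {f = f} {g} p fp≡gp f≗g-off-p x with p ≟ᶠ x
... | yes refl = fp≡gp
... | no p≢x = subst (λ z → f z ≡ g z) (punchIn-punchOut p≢x) (f≗g-off-p (punchOut p≢x))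

∷-∘-permutation : ∀ {n} {A : Set} (π : Permutation′ (suc n)) (a : A) (h : Fin n → A) →
  let p = π ⟨$⟩ˡ zero in
  (a ∷ᶠ h) ∘ (π ⟨$⟩ʳ_) ≗ insertAt (h ∘ (remove p π ⟨$⟩ʳ_)) p a
∷-∘-permutation π a h = ≗-punchIn p
  (trans (cong (a ∷ᶠ h) (inverseʳ π)) (sym (insertAt-lookup _ p a)))
  (λ y → trans (cong (a ∷ᶠ h) (punchIn-permute′ π zero y)) (sym (insertAt-punchIn _ p a y)))
  where p = π ⟨$⟩ˡ zero

filter-cong : ∀ {A : Set} {P Q : Pred A 0ℓ} (P? : Decidable P) (Q? : Decidable Q) →
  (∀ x → does (P? x) ≡ does (Q? x)) → filter P? ≗ filter Q?
filter-cong P? Q? P≡Q [] = refl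
filter-cong P? Q? P≡Q (x ∷ xs) with does (P? x) | does (Q? x) | P≡Q x
... | true  | true  | refl = cong (x ∷_) (filter-cong P? Q? P≡Q xs)
... | false | false | refl = filter-cong P? Q? P≡Q xs

filter-map : ∀ {A B : Set} {P : Pred B 0ℓ} (P? : Decidable P) (g : A → B) xs →
  filter P? (map g xs) ≡ map g (filter (P? ∘ g) xs)
filter-map P? g [] = refl
filter-map P? g (x ∷ xs) with does (P? (g x))
... | true  = cong (g x ∷_) (filter-map P? g xs)
... | false = filter-map P? g xs

insertAt-cong : ∀ {n} {A : Set} {g h : Fin n → A} → g ≗ h → ∀ p a → insertAt g p a ≗ insertAt h p a
insertAt-cong {g = g} {h} g≗h p a = ≗-punchIn p
  (trans (insertAt-lookup g p a) (sym (insertAt-lookup h p a)))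
  (λ y → trans (insertAt-punchIn g p a y) (trans (g≗h y) (sym (insertAt-punchIn h p a y))))

block-cong : ∀ {n k} {f g : Fin n → Fin k} → f ≗ g → ∀ j → block f j ≡ block g j
block-cong {f = f} {g} f≗g j =
  filter-cong (λ x → f x ≟ᶠ j) (λ x → g x ≟ᶠ j) (λ x → cong (λ y → does (y ≟ᶠ j)) (f≗g x)) (allFin _)

module ℕSum = CommutativeMonoidSum +-0-commutativeMonoid

indicator : Bool → ℕ
indicator b = if b then 1 else 0

length-filter-tabulate : ∀ {A : Set} {P : Pred A 0ℓ} (P? : Decidable P) {m} (h : Fin m → A) →
  length (filter P? (tabulate h)) ≡ ℕSum.sum (λ i → indicator (does (P? (h i))))
length-filter-tabulate P? {zero} h = refl
length-filter-tabulate P? {suc m} h with does (P? (h zero))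
... | true  = cong suc (length-filter-tabulate P? (h ∘ suc))
... | false = length-filter-tabulate P? (h ∘ suc)

length-block-∘-permutation : ∀ {n k} (π : Permutation′ n) (f : Fin n → Fin k) j →
  length (block (f ∘ (π ⟨$⟩ʳ_)) j) ≡ length (block f j)
length-block-∘-permutation π f j = begin
  length (block (f ∘ (π ⟨$⟩ʳ_)) j)                      ≡⟨ length-filter-tabulate (λ x → f (π ⟨$⟩ʳ x) ≟ᶠ j) id ⟩
  ℕSum.sum (λ x → indicator (does (f (π ⟨$⟩ʳ x) ≟ᶠ j))) ≡⟨ sym (ℕSum.sum-permute (λ y → indicator (does (f y ≟ᶠ j))) π) ⟩
  ℕSum.sum (λ y → indicator (does (f y ≟ᶠ j)))          ≡⟨ sym (length-filter-tabulate (λ y → f y ≟ᶠ j) id) ⟩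
  length (block f j)                                    ∎
  where open ≡-Reasoning

hasSizes-∘-permutation : ∀ {n} (α : List ℕ) (π : Permutation′ n) (f : Fin n → Fin (length α)) →
  hasSizes α (f ∘ (π ⟨$⟩ʳ_)) ≡ hasSizes α f
hasSizes-∘-permutation α π f = foldr-cong
  (λ j b → cong (λ size → (size ≡ᵇ List.lookup α j) ∧ b) (length-block-∘-permutation π f j)) refl (allFin (length α))

hasSizes-cong : ∀ {n} (α : List ℕ) {f g : Fin n → Fin (length α)} → f ≗ g → hasSizes α f ≡ hasSizes α g
hasSizes-cong α f≗g = foldr-cong
  (λ j b → cong (λ B → (length B ≡ᵇ List.lookup α j) ∧ b) (block-cong f≗g j)) refl (allFin (length α))

-- Words and their poset matrices

nth : ∀ {A : Set} → A → List A → ℕ → A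
nth d [] i = d
nth d (x ∷ xs) zero = x
nth d (x ∷ xs) (suc i) = nth d xs i

_!_ : List ℕ → ℕ → ℕ
_!_ = nth 0

<ᵇ-true : ∀ m n → m < n → (m <ᵇ n) ≡ true
<ᵇ-true zero (suc n) _ = refl
<ᵇ-true (suc m) (suc n) (s≤s m<n) = <ᵇ-true m n m<n

<ᵇ-false : ∀ m n → n ≤ m → (m <ᵇ n) ≡ false
<ᵇ-false m zero _ = refl
<ᵇ-false (suc m) (suc n) (s≤s n≤m) = <ᵇ-false m n n≤m

<ᵇ-true⇒< : ∀ m n → (m <ᵇ n) ≡ true → m < n
<ᵇ-true⇒< zero (suc n) _ = s≤s z≤n
<ᵇ-true⇒< (suc m) (suc n) m<ᵇn = s≤s (<ᵇ-true⇒< m n m<ᵇn)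

<ᵇ-irrefl : ∀ m → (m <ᵇ m) ≡ false
<ᵇ-irrefl m = <ᵇ-false m m ≤-refl

+-<ᵇ-cancelˡ : ∀ i r s → (i + r <ᵇ i + s) ≡ (r <ᵇ s)
+-<ᵇ-cancelˡ zero r s = refl
+-<ᵇ-cancelˡ (suc i) r s = +-<ᵇ-cancelˡ i r s

<ᵇ-flip : ∀ a b → a ≢ b → (a <ᵇ b) ≡ not (b <ᵇ a)
<ᵇ-flip a b a≢b with <-cmp a b
... | tri< a<b _ _ = trans (<ᵇ-true a b a<b) (cong not (sym (<ᵇ-false b a (<⇒≤ a<b))))
... | tri≈ _ a≡b _ = ⊥-elim (a≢b a≡b)
... | tri> _ _ b<a = trans (<ᵇ-false a b (<⇒≤ b<a)) (cong not (sym (<ᵇ-true b a b<a)))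

<∸⇒+< : ∀ i r n → r < n ∸ i → i + r < n
<∸⇒+< zero r n r<n = r<n
<∸⇒+< (suc i) r (suc n) r<n∸i = s≤s (<∸⇒+< i r n r<n∸i)

applyUpTo-nth : ∀ {A : Set} (d : A) xs → xs ≡ applyUpTo (nth d xs) (length xs)
applyUpTo-nth d [] = refl
applyUpTo-nth d (x ∷ xs) = cong (x ∷_) (applyUpTo-nth d xs)

nth-applyUpTo : ∀ {A : Set} (d : A) k (g : ℕ → A) r → r < k → nth d (applyUpTo g k) r ≡ g r
nth-applyUpTo d (suc k) g zero _ = refl
nth-applyUpTo d (suc k) g (suc r) (s≤s r<k) = nth-applyUpTo d k (g ∘ suc) r r<k

nth-map : ∀ {A B : Set} (d : A) (d′ : B) (f : A → B) xs r → r < length xs →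
  nth d′ (map f xs) r ≡ f (nth d xs r)
nth-map d d′ f (x ∷ xs) zero _ = refl
nth-map d d′ f (x ∷ xs) (suc r) (s≤s r<) = nth-map d d′ f xs r r<

nth-∈ : ∀ w r → r < length w → w ! r ∈ w
nth-∈ (x ∷ w) zero _ = here refl
nth-∈ (x ∷ w) (suc r) (s≤s r<) = there (nth-∈ w r r<)

nth-take : ∀ i w r → r < i → take i w ! r ≡ w ! r
nth-take (suc i) [] r _ = refl
nth-take (suc i) (x ∷ w) zero _ = refl
nth-take (suc i) (x ∷ w) (suc r) (s≤s r<i) = nth-take i w r r<i

nth-drop : ∀ i w r → drop i w ! r ≡ w ! (i + r)
nth-drop zero w r = refl
nth-drop (suc i) [] r = refl
nth-drop (suc i) (x ∷ w) r = nth-drop i w r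

take-applyUpTo : ∀ {A : Set} i k (g : ℕ → A) → i ≤ k → take i (applyUpTo g k) ≡ applyUpTo g i
take-applyUpTo zero k g _ = refl
take-applyUpTo (suc i) (suc k) g (s≤s i≤k) = cong (g 0 ∷_) (take-applyUpTo i k (g ∘ suc) i≤k)

drop-applyUpTo : ∀ {A : Set} i k (g : ℕ → A) → drop i (applyUpTo g k) ≡ applyUpTo (λ r → g (i + r)) (k ∸ i)
drop-applyUpTo zero k g = refl
drop-applyUpTo (suc i) zero g = refl
drop-applyUpTo (suc i) (suc k) g = drop-applyUpTo i k (g ∘ suc)

length-take-≤ : ∀ {A : Set} i (w : List A) → i ≤ length w → length (take i w) ≡ i
length-take-≤ i w i≤ = trans (length-take i w) (m≤n⇒m⊓n≡m i≤)

map-applyUpTo-cong : ∀ {A A′ B : Set} k {g : ℕ → A} {h : ℕ → A′} (F : A → B) (F′ : A′ → B) →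
  (∀ r → r < k → F (g r) ≡ F′ (h r)) → map F (applyUpTo g k) ≡ map F′ (applyUpTo h k)
map-applyUpTo-cong zero F F′ F≡F′ = refl
map-applyUpTo-cong (suc k) F F′ F≡F′ =
  cong₂ _∷_ (F≡F′ 0 (s≤s z≤n)) (map-applyUpTo-cong k F F′ (λ r r<k → F≡F′ (suc r) (s≤s r<k)))

foldr-applyUpTo-cong : ∀ {A A′ B : Set} k {g : ℕ → A} {h : ℕ → A′} (c : A → B → B) (c′ : A′ → B → B) e →
  (∀ r → r < k → ∀ acc → c (g r) acc ≡ c′ (h r) acc) →
  List.foldr c e (applyUpTo g k) ≡ List.foldr c′ e (applyUpTo h k)
foldr-applyUpTo-cong zero c c′ e c≡c′ = refl
foldr-applyUpTo-cong (suc k) c c′ e c≡c′ =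
  trans (c≡c′ 0 (s≤s z≤n) _)
        (cong (c′ _) (foldr-applyUpTo-cong k c c′ e (λ r r<k → c≡c′ (suc r) (s≤s r<k))))

relMatrix : ∀ {X : Set} → (X → X → Bool) → List X → List (List Bool)
relMatrix R xs = map (λ a → map (R a) xs) xs

relMatrix-map : ∀ {A B : Set} (R : B → B → Bool) (g : A → B) xs →
  relMatrix R (map g xs) ≡ relMatrix (λ a b → R (g a) (g b)) xs
relMatrix-map R g xs = trans (sym (map-∘ xs)) (map-cong (λ a → sym (map-∘ xs)) xs)

relMatrix-applyUpTo-cong : ∀ {A B : Set} k {g : ℕ → A} {h : ℕ → B} (R : A → A → Bool) (R′ : B → B → Bool) →
  (∀ r s → r < k → s < k → R (g r) (g s) ≡ R′ (h r) (h s)) →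
  relMatrix R (applyUpTo g k) ≡ relMatrix R′ (applyUpTo h k)
relMatrix-applyUpTo-cong k R R′ R≡R′ =
  map-applyUpTo-cong k _ _ (λ r r<k → map-applyUpTo-cong k _ _ (λ s s<k → R≡R′ r s r<k s<k))

entry-head : ∀ row M s → entry (row ∷ M) 0 s ≡ nth false row s
entry-head [] M s = refl
entry-head (x ∷ row) M zero = refl
entry-head (x ∷ row) M (suc s) = entry-head row M s

entry-map : ∀ {A : Set} (d : A) (F : A → List Bool) xs r s → r < length xs →
  entry (map F xs) r s ≡ nth false (F (nth d xs r)) s
entry-map d F (x ∷ xs) zero s _ = entry-head (F x) (map F xs) s
entry-map d F (x ∷ xs) (suc r) s (s≤s r<) = entry-map d F xs r s r<

entry-relMatrix : ∀ {A : Set} (d : A) (R : A → A → Bool) xs r s → r < length xs → s < length xs →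
  entry (relMatrix R xs) r s ≡ R (nth d xs r) (nth d xs s)
entry-relMatrix d R xs r s r< s< =
  trans (entry-map d (λ a → map (R a) xs) xs r s r<) (nth-map d false (R (nth d xs r)) xs s s<)

wordOrder : List ℕ → ℕ → ℕ → Bool
wordOrder w r s = (r <ᵇ s) ∧ (w ! r <ᵇ w ! s)

wordMatrix : List ℕ → List (List Bool)
wordMatrix w = relMatrix (wordOrder w) (upTo (length w))

length-wordMatrix : ∀ w → length (wordMatrix w) ≡ length w
length-wordMatrix w = trans (length-map _ (upTo (length w))) (length-upTo (length w))

entry-wordMatrix : ∀ w r s → r < length w → s < length w → entry (wordMatrix w) r s ≡ wordOrder w r s
entry-wordMatrix w r s r< s< = trans
  (entry-relMatrix 0 (wordOrder w) (upTo n) r s (subst (r <_) (sym (length-upTo n)) r<) (subst (s <_) (sym (length-upTo n)) s<))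
  (cong₂ (wordOrder w) (nth-applyUpTo 0 n id r r<) (nth-applyUpTo 0 n id s s<))
  where n = length w

wordMatrix-cong : ∀ u w → length u ≡ length w →
  (∀ r s → r < length u → s < length u → (u ! r <ᵇ u ! s) ≡ (w ! r <ᵇ w ! s)) →
  wordMatrix u ≡ wordMatrix w
wordMatrix-cong u w |u|≡|w| same-order =
  trans (relMatrix-applyUpTo-cong (length u) (wordOrder u) (wordOrder w)
          (λ r s r< s< → cong ((r <ᵇ s) ∧_) (same-order r s r< s<)))
        (cong (λ n → relMatrix (wordOrder w) (upTo n)) |u|≡|w|)

countᵇ : ∀ {A : Set} → (A → Bool) → List A → ℕ
countᵇ p = List.foldr (λ x n → indicator (p x) + n) 0

length-filter : ∀ {A : Set} {P : Pred A 0ℓ} (P? : Decidable P) xs → length (filter P? xs) ≡ countᵇ (does ∘ P?) xs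
length-filter P? [] = refl
length-filter P? (x ∷ xs) with does (P? x)
... | true  = cong suc (length-filter P? xs)
... | false = length-filter P? xs

rank : List ℕ → ℕ → ℕ
rank w x = countᵇ (_<ᵇ x) w

st≡map-rank : ∀ w → st w ≡ map (rank w) w
st≡map-rank w = map-cong (λ x → length-filter (_<? x) w) w

rank-mono : ∀ w {a b} → a ≤ b → rank w a ≤ rank w b
rank-mono [] a≤b = z≤n
rank-mono (y ∷ ys) {a} {b} a≤b with y <ᵇ a in y<ᵇa
... | true rewrite <ᵇ-true y b (<-≤-trans (<ᵇ-true⇒< y a y<ᵇa) a≤b) = s≤s (rank-mono ys a≤b)
... | false = ≤-trans (rank-mono ys a≤b) (m≤n+m _ _)

rank-strict : ∀ w {a b} → a < b → a ∈ w → rank w a < rank w b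
rank-strict (y ∷ ys) {a} {b} a<b (here refl) rewrite <ᵇ-irrefl a | <ᵇ-true a b a<b =
  s≤s (rank-mono ys (<⇒≤ a<b))
rank-strict (y ∷ ys) {a} {b} a<b (there a∈ys) with y <ᵇ a in y<ᵇa
... | true rewrite <ᵇ-true y b (<-trans (<ᵇ-true⇒< y a y<ᵇa) a<b) = s≤s (rank-strict ys a<b a∈ys)
... | false = <-≤-trans (rank-strict ys a<b a∈ys) (m≤n+m _ _)

rank-<ᵇ : ∀ w {a b} → a ∈ w → b ∈ w → (rank w a <ᵇ rank w b) ≡ (a <ᵇ b)
rank-<ᵇ w {a} {b} a∈ b∈ with <-cmp a b
... | tri< a<b _ _ = trans (<ᵇ-true _ _ (rank-strict w a<b a∈)) (sym (<ᵇ-true a b a<b))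
... | tri≈ _ refl _ = trans (<ᵇ-irrefl (rank w a)) (sym (<ᵇ-irrefl a))
... | tri> _ _ b<a = trans (<ᵇ-false _ _ (<⇒≤ (rank-strict w b<a b∈))) (sym (<ᵇ-false a b (<⇒≤ b<a)))

rank-injective : ∀ w {a b} → a ∈ w → b ∈ w → rank w a ≡ rank w b → a ≡ b
rank-injective w {a} {b} a∈ b∈ ra≡rb with <-cmp a b
... | tri< a<b _ _ = ⊥-elim (<⇒≢ (rank-strict w a<b a∈) ra≡rb)
... | tri≈ _ a≡b _ = a≡b
... | tri> _ _ b<a = ⊥-elim (<⇒≢ (rank-strict w b<a b∈) (sym ra≡rb))

length-st : ∀ w → length (st w) ≡ length w
length-st w = length-map _ w

nth-st : ∀ w r → r < length w → st w ! r ≡ rank w (w ! r)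
nth-st w r r< = trans (cong (_! r) (st≡map-rank w)) (nth-map 0 0 (rank w) w r r<)

wordMatrix-st : ∀ w → wordMatrix (st w) ≡ wordMatrix w
wordMatrix-st w = wordMatrix-cong (st w) w (length-st w) λ r s r< s< →
  let r<′ = subst (r <_) (length-st w) r< ; s<′ = subst (s <_) (length-st w) s< in
  trans (cong₂ _<ᵇ_ (nth-st w r r<′) (nth-st w s s<′)) (rank-<ᵇ w (nth-∈ w r r<′) (nth-∈ w s s<′))

st-Unique : ∀ w → Unique w → Unique (st w)
st-Unique w u = subst Unique (sym (st≡map-rank w)) (APP.map⁺ (rank-≢ (All-∈ w) u))
  where
  All-∈ : ∀ (xs : List ℕ) → All (_∈ xs) xs
  All-∈ [] = []
  All-∈ (x ∷ xs) = here refl ∷ All.map there (All-∈ xs)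
  rank-≢ : ∀ {xs} → All (_∈ w) xs → AllPairs _≢_ xs → AllPairs (λ a b → rank w a ≢ rank w b) xs
  rank-≢ [] [] = []
  rank-≢ (a∈ ∷ as∈) (a∉ ∷ u′) =
    All.zipWith (λ (b∈ , a≢b) → a≢b ∘ rank-injective w a∈ b∈) (as∈ , a∉) ∷ rank-≢ as∈ u′

-- In a word with distinct letters, w k < w i iff k is below i in the poset of w,
-- or k lies to the right of i without being above it; so the ranks of the
-- letters can be read off the poset matrix.
valueBelow : List (List Bool) → ℕ → ℕ → Bool
valueBelow M k i = entry M k i ∨ ((i <ᵇ k) ∧ not (entry M i k))

reconstruct : List (List Bool) → List ℕ
reconstruct M = map (λ i → countᵇ (λ k → valueBelow M k i) (upTo (length M))) (upTo (length M))

nth-≢ : ∀ v {k i} → Unique v → k ≢ i → k < length v → i < length v → v ! k ≢ v ! i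
nth-≢ (x ∷ v) {zero} {zero} u k≢i _ _ = ⊥-elim (k≢i refl)
nth-≢ (x ∷ v) {zero} {suc i} (x∉ ∷ _) _ _ (s≤s i<) = All.lookup x∉ (nth-∈ v i i<)
nth-≢ (x ∷ v) {suc k} {zero} (x∉ ∷ _) _ (s≤s k<) _ = All.lookup x∉ (nth-∈ v k k<) ∘ sym
nth-≢ (x ∷ v) {suc k} {suc i} (_ ∷ u) k≢i (s≤s k<) (s≤s i<) = nth-≢ v u (k≢i ∘ cong suc) k< i<

valueBelow-wordMatrix : ∀ v {k i} → Unique v → k < length v → i < length v →
  valueBelow (wordMatrix v) k i ≡ (v ! k <ᵇ v ! i)
valueBelow-wordMatrix v {k} {i} u k< i< rewrite entry-wordMatrix v k i k< i< | entry-wordMatrix v i k i< k<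
  with <-cmp k i
... | tri< k<i _ _ rewrite <ᵇ-true k i k<i | <ᵇ-false i k (<⇒≤ k<i) = ∨-identityʳ _
... | tri≈ _ refl _ rewrite <ᵇ-irrefl k | <ᵇ-irrefl (v ! k) = refl
... | tri> _ _ i<k rewrite <ᵇ-false k i (<⇒≤ i<k) | <ᵇ-true i k i<k =
  sym (<ᵇ-flip (v ! k) (v ! i) (nth-≢ v u (λ k≡i → <⇒≢ i<k (sym k≡i)) k< i<))

st≡reconstruct : ∀ v → Unique v → st v ≡ reconstruct (wordMatrix v)
st≡reconstruct v u = begin
  st v                                          ≡⟨ st≡map-rank v ⟩
  map (rank v) v                                ≡⟨ cong (map (rank v)) (applyUpTo-nth 0 v) ⟩
  map (rank v) (applyUpTo (v !_) n)             ≡⟨ map-applyUpTo-cong n (rank v) ranks rank≡ ⟩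
  map ranks (upTo n)                            ≡⟨ cong (λ m → map (ranks′ m) (upTo m)) (length-wordMatrix v) ⟨
  reconstruct (wordMatrix v)                    ∎
  where
  open ≡-Reasoning
  n = length v
  ranks′ : ℕ → ℕ → ℕ
  ranks′ m i = countᵇ (λ k → valueBelow (wordMatrix v) k i) (upTo m)
  ranks = ranks′ n
  rank≡ : ∀ i → i < n → rank v (v ! i) ≡ ranks i
  rank≡ i i< = trans (cong (countᵇ (_<ᵇ v ! i)) (applyUpTo-nth 0 v))
    (foldr-applyUpTo-cong n _ _ 0 λ k k< acc →
      cong (λ b → indicator b + acc) (sym (valueBelow-wordMatrix v u k< i<)))

submatrix-take : ∀ w i → i ≤ length w → submatrix (wordMatrix w) (upTo i) ≡ wordMatrix (take i w)
submatrix-take w i i≤ =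
  trans (relMatrix-applyUpTo-cong i (entry (wordMatrix w)) (wordOrder (take i w)) entry≡)
        (cong (λ m → relMatrix (wordOrder (take i w)) (upTo m)) (sym (length-take-≤ i w i≤)))
  where
  entry≡ : ∀ r s → r < i → s < i → entry (wordMatrix w) r s ≡ wordOrder (take i w) r s
  entry≡ r s r< s< = trans (entry-wordMatrix w r s (<-≤-trans r< i≤) (<-≤-trans s< i≤))
    (cong₂ (λ a b → (r <ᵇ s) ∧ (a <ᵇ b)) (sym (nth-take i w r r<)) (sym (nth-take i w s s<)))

submatrix-drop : ∀ w i → submatrix (wordMatrix w) (drop i (upTo (length w))) ≡ wordMatrix (drop i w)
submatrix-drop w i =
  trans (cong (relMatrix (entry (wordMatrix w))) (drop-applyUpTo i n id))
  (trans (relMatrix-applyUpTo-cong (n ∸ i) (entry (wordMatrix w)) (wordOrder (drop i w)) entry≡)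
         (cong (λ m → relMatrix (wordOrder (drop i w)) (upTo m)) (sym (length-drop i w))))
  where
  n = length w
  entry≡ : ∀ r s → r < n ∸ i → s < n ∸ i → entry (wordMatrix w) (i + r) (i + s) ≡ wordOrder (drop i w) r s
  entry≡ r s r< s< = trans (entry-wordMatrix w (i + r) (i + s) (<∸⇒+< i r n r<) (<∸⇒+< i s n s<))
    (cong₂ _∧_ (+-<ᵇ-cancelˡ i r s) (cong₂ _<ᵇ_ (sym (nth-drop i w r)) (sym (nth-drop i w s))))

isAscentᵇ≡isSplitᵇ : ∀ w i → isAscentᵇ w i ≡ isSplitᵇ (wordMatrix w) i
isAscentᵇ≡isSplitᵇ w i rewrite length-wordMatrix w = cong ((1 ≤ᵇ i) ∧_) in-range
  where
  n = length w
  M = wordMatrix w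
  lower<upper : ∀ r k → r < i → i < n → k < n ∸ i →
    (w ! r <ᵇ w ! (i + k)) ≡ (entry M r (i + k) ∧ not (entry M (i + k) r))
  lower<upper r k r<i i<n k< rewrite entry-wordMatrix w r (i + k) (<-trans r<i i<n) (<∸⇒+< i k n k<)
                                   | entry-wordMatrix w (i + k) r (<∸⇒+< i k n k<) (<-trans r<i i<n)
                                   | <ᵇ-true r (i + k) (<-≤-trans r<i (m≤m+n i k))
                                   | <ᵇ-false (i + k) r (≤-trans (<⇒≤ r<i) (m≤m+n i k))
    = sym (∧-identityʳ _)
  ascent≡split : i < n →
    allᵇ (λ a → allᵇ (λ b → a <ᵇ b) (drop i w)) (take i w) ≡
    allᵇ (λ r → allᵇ (λ s → entry M r s ∧ not (entry M s r)) (drop i (upTo n))) (upTo i)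
  ascent≡split i<n = begin
    allᵇ (λ a → allᵇ (λ b → a <ᵇ b) (drop i w)) (take i w)
      ≡⟨ cong₂ (λ T D → allᵇ (λ a → allᵇ (λ b → a <ᵇ b) D) T)
           (trans (cong (take i) (applyUpTo-nth 0 w)) (take-applyUpTo i n (w !_) (<⇒≤ i<n)))
           (trans (cong (drop i) (applyUpTo-nth 0 w)) (drop-applyUpTo i n (w !_))) ⟩
    allᵇ (λ a → allᵇ (λ b → a <ᵇ b) (applyUpTo (λ k → w ! (i + k)) (n ∸ i))) (applyUpTo (w !_) i)
      ≡⟨ foldr-applyUpTo-cong i _ _ true (λ r r<i acc → cong (_∧ acc)
           (foldr-applyUpTo-cong (n ∸ i) _ _ true (λ k k< acc′ → cong (_∧ acc′) (lower<upper r k r<i i<n k<)))) ⟩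
    allᵇ (λ r → allᵇ (λ s → entry M r s ∧ not (entry M s r)) (applyUpTo (i +_) (n ∸ i))) (upTo i)
      ≡⟨ cong (λ D → allᵇ (λ r → allᵇ (λ s → entry M r s ∧ not (entry M s r)) D) (upTo i))
           (drop-applyUpTo i n id) ⟨
    allᵇ (λ r → allᵇ (λ s → entry M r s ∧ not (entry M s r)) (drop i (upTo n))) (upTo i) ∎
    where open ≡-Reasoning
  in-range : ((i <ᵇ n) ∧ allᵇ (λ a → allᵇ (λ b → a <ᵇ b) (drop i w)) (take i w)) ≡
             ((i <ᵇ n) ∧ allᵇ (λ r → allᵇ (λ s → entry M r s ∧ not (entry M s r)) (drop i (upTo n))) (upTo i))
  in-range with i <ᵇ n in i<ᵇn
  ... | false = refl
  ... | true = cong (true ∧_) (ascent≡split (<ᵇ-true⇒< i n i<ᵇn))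

-- Factorizations

cutWord : ℕ → List ℕ → Maybe ℕ → List (List ℕ)
cutWord f w nothing = st w ∷ []
cutWord f w (just i) = st (take i w) ∷ factorsWord f (st (drop i w))

cutPoset : ℕ → List (List Bool) → Maybe ℕ → List (List (List Bool))
cutPoset f M nothing = M ∷ []
cutPoset f M (just i) = submatrix M (upTo i) ∷ factorsPoset f (submatrix M (drop i (upTo (length M))))

factorsWord-suc : ∀ f w → w ≢ [] → factorsWord (suc f) w ≡ cutWord f w (first (isAscentᵇ w) (upTo (length w)))
factorsWord-suc f [] w≢[] = ⊥-elim (w≢[] refl)
factorsWord-suc f (x ∷ xs) _ with first (isAscentᵇ (x ∷ xs)) (upTo (length (x ∷ xs)))
... | nothing = refl
... | just i = refl

factorsPoset-suc : ∀ f M → M ≢ [] → factorsPoset (suc f) M ≡ cutPoset f M (first (isSplitᵇ M) (upTo (length M)))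
factorsPoset-suc f [] M≢[] = ⊥-elim (M≢[] refl)
factorsPoset-suc f (r ∷ rs) _ with first (isSplitᵇ (r ∷ rs)) (upTo (length (r ∷ rs)))
... | nothing = refl
... | just i = refl

first-cong : ∀ {p q : ℕ → Bool} → p ≗ q → first p ≗ first q
first-cong p≗q [] = refl
first-cong {p} {q} p≗q (x ∷ xs) rewrite p≗q x with q x
... | true = refl
... | false = first-cong p≗q xs

first-satisfies : ∀ (p : ℕ → Bool) xs {i} → first p xs ≡ just i → p i ≡ true
first-satisfies p (x ∷ xs) eq with p x in px
first-satisfies p (x ∷ xs) refl | true = px
first-satisfies p (x ∷ xs) eq | false = first-satisfies p xs eq

isAscentᵇ⇒≤ : ∀ w i → isAscentᵇ w i ≡ true → i ≤ length w
isAscentᵇ⇒≤ w i ascent with 1 ≤ᵇ i | i <ᵇ length w in i<ᵇn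
isAscentᵇ⇒≤ w i () | false | _
isAscentᵇ⇒≤ w i () | true | false
... | true | true = <⇒≤ (<ᵇ-true⇒< i (length w) i<ᵇn)

factorsPoset-wordMatrix : ∀ f w → factorsPoset f (wordMatrix w) ≡ map wordMatrix (factorsWord f w)
factorsPoset-wordMatrix f [] = refl
factorsPoset-wordMatrix zero (x ∷ xs) = refl
factorsPoset-wordMatrix (suc f) w@(x ∷ xs) = begin
  factorsPoset (suc f) (wordMatrix w)
    ≡⟨ factorsPoset-suc f (wordMatrix w) (λ ()) ⟩
  cutPoset f (wordMatrix w) (first (isSplitᵇ (wordMatrix w)) (upTo (length (wordMatrix w))))
    ≡⟨ cong (cutPoset f (wordMatrix w)) firstSplit≡firstAscent ⟩
  cutPoset f (wordMatrix w) (first (isAscentᵇ w) (upTo (length w)))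
    ≡⟨ cut≡ (first (isAscentᵇ w) (upTo (length w))) (λ eq → isAscentᵇ⇒≤ w _ (first-satisfies (isAscentᵇ w) (upTo (length w)) eq)) ⟩
  map wordMatrix (cutWord f w (first (isAscentᵇ w) (upTo (length w))))
    ≡⟨ cong (map wordMatrix) (factorsWord-suc f w (λ ())) ⟨
  map wordMatrix (factorsWord (suc f) w) ∎
  where
  open ≡-Reasoning
  firstSplit≡firstAscent : first (isSplitᵇ (wordMatrix w)) (upTo (length (wordMatrix w))) ≡ first (isAscentᵇ w) (upTo (length w))
  firstSplit≡firstAscent = trans (first-cong (sym ∘ isAscentᵇ≡isSplitᵇ w) (upTo (length (wordMatrix w)))) (cong (first (isAscentᵇ w) ∘ upTo) (length-wordMatrix w))
  cut≡ : ∀ m → (∀ {i} → m ≡ just i → i ≤ length w) → cutPoset f (wordMatrix w) m ≡ map wordMatrix (cutWord f w m)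
  cut≡ nothing _ = cong (_∷ []) (sym (wordMatrix-st w))
  cut≡ (just i) i≤ = cong₂ _∷_
    (trans (submatrix-take w i (i≤ refl)) (sym (wordMatrix-st (take i w))))
    (begin
      factorsPoset f (submatrix (wordMatrix w) (drop i (upTo (length (wordMatrix w)))))
        ≡⟨ cong (λ m → factorsPoset f (submatrix (wordMatrix w) (drop i (upTo m)))) (length-wordMatrix w) ⟩
      factorsPoset f (submatrix (wordMatrix w) (drop i (upTo (length w))))
        ≡⟨ cong (factorsPoset f) (trans (submatrix-drop w i) (sym (wordMatrix-st (drop i w)))) ⟩
      factorsPoset f (wordMatrix (st (drop i w)))
        ≡⟨ factorsPoset-wordMatrix f (st (drop i w)) ⟩
      map wordMatrix (factorsWord f (st (drop i w))) ∎)

Standard : List ℕ → Set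
Standard w = ∃ λ v → Unique v × w ≡ st v

Standard⇒Unique : ∀ {w} → Standard w → Unique w
Standard⇒Unique (v , u , refl) = st-Unique v u

Standard⇒reconstruct : ∀ {w} → Standard w → w ≡ reconstruct (wordMatrix w)
Standard⇒reconstruct (v , u , refl) = trans (st≡reconstruct v u) (cong reconstruct (sym (wordMatrix-st v)))

wordMatrix-injective : ∀ {u w} → Standard u → Standard w → wordMatrix u ≡ wordMatrix w → u ≡ w
wordMatrix-injective std-u std-w eq =
  trans (Standard⇒reconstruct std-u) (trans (cong reconstruct eq) (sym (Standard⇒reconstruct std-w)))

factorsWord-Standard : ∀ f {w} → Standard w → All Standard (factorsWord f w)
factorsWord-Standard f {[]} std = []
factorsWord-Standard zero {x ∷ xs} std = std ∷ []
factorsWord-Standard (suc f) {w@(x ∷ xs)} std =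
  subst (All Standard) (sym (factorsWord-suc f w (λ ()))) (cut-Standard (first (isAscentᵇ w) (upTo (length w))))
  where
  u = Standard⇒Unique std
  cut-Standard : ∀ m → All Standard (cutWord f w m)
  cut-Standard nothing = (w , u , refl) ∷ []
  cut-Standard (just i) = (take i w , UP.take⁺ i u , refl) ∷ factorsWord-Standard f (drop i w , UP.drop⁺ i u , refl)

-- Permutations

Increasing : List ℕ → Set
Increasing = AllPairs _<_

nth-increasing-<ᵇ : ∀ ys r s → Increasing ys → r < length ys → s < length ys → (ys ! r <ᵇ ys ! s) ≡ (r <ᵇ s)
nth-increasing-<ᵇ (y ∷ ys) zero zero _ _ _ = <ᵇ-irrefl y
nth-increasing-<ᵇ (y ∷ ys) zero (suc s) (y< ∷ _) _ (s≤s s<) = <ᵇ-true y (ys ! s) (All.lookup y< (nth-∈ ys s s<))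
nth-increasing-<ᵇ (y ∷ ys) (suc r) zero (y< ∷ _) (s≤s r<) _ = <ᵇ-false (ys ! r) y (<⇒≤ (All.lookup y< (nth-∈ ys r r<)))
nth-increasing-<ᵇ (y ∷ ys) (suc r) (suc s) (_ ∷ inc) (s≤s r<) (s≤s s<) = nth-increasing-<ᵇ ys r s inc r< s<

valuesAt : ∀ {n} → Permutation′ n → List (Fin n) → List ℕ
valuesAt β = map (λ a → toℕ (β ⟨$⟩ʳ a))

-- Positions are paired with their letters so that no default element of Fin n is needed.
relMatrix-posetOf : ∀ {n} (β : Permutation′ n) B → Increasing (map toℕ B) →
  relMatrix (posetOf β) B ≡ wordMatrix (valuesAt β B)
relMatrix-posetOf {n} β B increasing = begin
  relMatrix (posetOf β) B
    ≡⟨ relMatrix-map bothBelow pair B ⟨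
  relMatrix bothBelow L
    ≡⟨ cong (relMatrix bothBelow) (applyUpTo-nth (0 , 0) L) ⟩
  relMatrix bothBelow (applyUpTo (nth (0 , 0) L) (length L))
    ≡⟨ relMatrix-applyUpTo-cong (length L) bothBelow (wordOrder v) entry≡ ⟩
  relMatrix (wordOrder v) (upTo (length L))
    ≡⟨ cong (relMatrix (wordOrder v) ∘ upTo) (trans (length-map pair B) (sym (length-map _ B))) ⟩
  wordMatrix v ∎
  where
  open ≡-Reasoning
  pair : Fin n → ℕ × ℕ
  pair a = toℕ a , toℕ (β ⟨$⟩ʳ a)
  bothBelow : ℕ × ℕ → ℕ × ℕ → Bool
  bothBelow (a , x) (b , y) = (a <ᵇ b) ∧ (x <ᵇ y)
  L = map pair B
  v = valuesAt β B
  positions = map toℕ B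
  nth-proj : ∀ (proj : ℕ × ℕ → ℕ) r → r < length L → proj (nth (0 , 0) L r) ≡ map (proj ∘ pair) B ! r
  nth-proj proj r r< = trans (sym (nth-map (0 , 0) 0 proj L r r<)) (cong (_! r) (sym (map-∘ B)))
  entry≡ : ∀ r s → r < length L → s < length L → bothBelow (nth (0 , 0) L r) (nth (0 , 0) L s) ≡ wordOrder v r s
  entry≡ r s r< s< = cong₂ _∧_
    (trans (cong₂ _<ᵇ_ (nth-proj proj₁ r r<) (nth-proj proj₁ s s<))
           (nth-increasing-<ᵇ positions r s increasing (subst (r <_) |L|≡ r<) (subst (s <_) |L|≡ s<)))
    (cong₂ _<ᵇ_ (nth-proj proj₂ r r<) (nth-proj proj₂ s s<))
    where |L|≡ = trans (length-map pair B) (sym (length-map toℕ B))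

allFin-increasing : ∀ n → Increasing (map toℕ (allFin n))
allFin-increasing n = APP.map⁺ (APP.tabulate⁺-< id)

block-increasing : ∀ {n k} (f : Fin n → Fin k) j → Increasing (map toℕ (block f j))
block-increasing {n} f j = APP.map⁺ (APP.filter⁺ (λ x → f x ≟ᶠ j) (APP.tabulate⁺-< id))

valuesAt-Unique : ∀ {n} (β : Permutation′ n) {B} → Unique B → Unique (valuesAt β B)
valuesAt-Unique β = UP.map⁺ λ {a} {b} βa≡βb →
  trans (sym (inverseˡ β)) (trans (cong (β ⟨$⟩ˡ_) (toℕ-injective βa≡βb)) (inverseˡ β))

restrictWord-block : ∀ {n k} (β : Permutation′ n) (f : Fin n → Fin k) j →
  restrictWord β (block f j) ≡ st (valuesAt β (block (f ∘ (β ⟨$⟩ʳ_)) j))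
restrictWord-block {n} β f j = cong st (begin
  map toℕ (filter (∈? (block f j)) (map (β ⟨$⟩ʳ_) (allFin n)))
    ≡⟨ cong (map toℕ) (filter-map (∈? (block f j)) (β ⟨$⟩ʳ_) (allFin n)) ⟩
  map toℕ (map (β ⟨$⟩ʳ_) (filter ((∈? (block f j)) ∘ (β ⟨$⟩ʳ_)) (allFin n)))
    ≡⟨ map-∘ (filter ((∈? (block f j)) ∘ (β ⟨$⟩ʳ_)) (allFin n)) ⟨
  valuesAt β (filter ((∈? (block f j)) ∘ (β ⟨$⟩ʳ_)) (allFin n))
    ≡⟨ cong (valuesAt β) (filter-cong ((∈? (block f j)) ∘ (β ⟨$⟩ʳ_)) (λ x → f (β ⟨$⟩ʳ x) ≟ᶠ j)
         (λ x → does-⇔ (∈-block (β ⟨$⟩ʳ x)) (∈? (block f j) (β ⟨$⟩ʳ x)) (f (β ⟨$⟩ʳ x) ≟ᶠ j)) (allFin n)) ⟩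
  valuesAt β (block (f ∘ (β ⟨$⟩ʳ_)) j) ∎)
  where
  open ≡-Reasoning
  ∈? : ∀ (A : List (Fin n)) x → Dec (Any (_≡ x) A)
  ∈? A x = any? (_≟ᶠ x) A
  ∈-block : ∀ y → Any (_≡ y) (block f j) ⇔ (f y ≡ j)
  ∈-block y = mk⇔ (λ y∈ → proj₂ (∈-filter⁻ (λ x → f x ≟ᶠ j) {xs = allFin n} (Any.map sym y∈)))
                  (λ fy≡j → Any.map sym (∈-filter⁺ (λ x → f x ≟ᶠ j) (∈-allFin y) fy≡j))

sum-indicator-<ᵇ : ∀ m x → x ≤ m → ℕSum.sum {m} (λ y → indicator (toℕ y <ᵇ x)) ≡ x
sum-indicator-<ᵇ zero zero z≤n = refl
sum-indicator-<ᵇ (suc m) zero z≤n = ℕSum.sum-replicate-zero (suc m)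
sum-indicator-<ᵇ (suc m) (suc x) (s≤s x≤m) = cong suc (sum-indicator-<ᵇ m x x≤m)

st-word : ∀ {m} (γ : Permutation′ m) → st (word γ) ≡ word γ
st-word {m} γ = trans (sym (map-∘ (allFin m))) (map-cong (λ i → rank-word (<⇒≤ (toℕ<n (γ ⟨$⟩ʳ i)))) (allFin m))
  where
  open ≡-Reasoning
  rank-word : ∀ {x} → x ≤ m → length (filter (_<? x) (word γ)) ≡ x
  rank-word {x} x≤m = begin
    length (filter (_<? x) (word γ))                      ≡⟨ cong (length ∘ filter (_<? x)) (map-tabulate id (λ i → toℕ (γ ⟨$⟩ʳ i))) ⟩
    length (filter (_<? x) (tabulate (λ i → toℕ (γ ⟨$⟩ʳ i)))) ≡⟨ length-filter-tabulate (_<? x) (λ i → toℕ (γ ⟨$⟩ʳ i)) ⟩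
    ℕSum.sum (λ i → indicator (toℕ (γ ⟨$⟩ʳ i) <ᵇ x))         ≡⟨ ℕSum.sum-permute (λ y → indicator (toℕ y <ᵇ x)) γ ⟨
    ℕSum.sum {m} (λ y → indicator (toℕ y <ᵇ x))             ≡⟨ sum-indicator-<ᵇ m x x≤m ⟩
    x ∎

word-Standard : ∀ {m} (γ : Permutation′ m) → Standard (word γ)
word-Standard {m} γ = word γ , valuesAt-Unique γ (UP.allFin⁺ m) , sym (st-word γ)

posetOf-indecomposable : ∀ {m} (γ : Permutation′ m) → IndecomposablePerm γ → IndecomposablePoset (posetOf γ)
posetOf-indecomposable γ indecomposable i (1≤i , i<m , split) = indecomposable i (1≤i , i<m , ascent)
  where
  ascent : ∀ r s → toℕ r < i → i ≤ toℕ s → toℕ (γ ⟨$⟩ʳ r) < toℕ (γ ⟨$⟩ʳ s)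
  ascent r s r<i i≤s with toℕ r <ᵇ toℕ s | proj₁ (split r s r<i i≤s)
  ... | true | γr<ᵇγs = <ᵇ-true⇒< _ _ γr<ᵇγs

-- Sums over ordered set partitions

module _ {c ℓ} (K : CommutativeRing c ℓ) where
  open CommutativeRing K using (Carrier; _≈_; _*_; 0#; +-commutativeMonoid; setoid)
    renaming (reflexive to ≈-reflexive)
  open CommutativeMonoidSum +-commutativeMonoid using (sum; ∑-comm; sum-cong-≋)
  open SetoidReasoning setoid

  Extensional : ∀ {n k} → ((Fin n → Fin k) → Carrier) → Set _
  Extensional F = ∀ {f g} → f ≗ g → F f ≈ F g

  sumFin≡sum : ∀ k (g : Fin k → Carrier) → sumFin K k g ≡ sum g
  sumFin≡sum k g = foldr-tabulate id
    where
    foldr-tabulate : ∀ {m} (h : Fin m → Fin k) →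
      List.foldr (λ j acc → CommutativeRing._+_ K (g j) acc) 0# (tabulate h) ≡ sum (g ∘ h)
    foldr-tabulate {zero} h = refl
    foldr-tabulate {suc m} h = cong (CommutativeRing._+_ K (g (h zero))) (foldr-tabulate (h ∘ suc))

  sumFuns-suc : ∀ n k F → sumFuns K (suc n) k F ≡ sum (λ j → sumFuns K n k (F ∘ (j ∷ᶠ_)))
  sumFuns-suc n k F = sumFin≡sum k _

  sumFuns-cong : ∀ n k {F G} → (∀ f → F f ≈ G f) → sumFuns K n k F ≈ sumFuns K n k G
  sumFuns-cong zero k F≈G = F≈G _
  sumFuns-cong (suc n) k {F} {G} F≈G = begin
    sumFuns K (suc n) k F                        ≡⟨ sumFuns-suc n k F ⟩
    sum (λ j → sumFuns K n k (F ∘ (j ∷ᶠ_)))       ≈⟨ sum-cong-≋ (λ j → sumFuns-cong n k (F≈G ∘ (j ∷ᶠ_))) ⟩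
    sum (λ j → sumFuns K n k (G ∘ (j ∷ᶠ_)))       ≡⟨ sumFuns-suc n k G ⟨
    sumFuns K (suc n) k G                        ∎

  sumFuns-insertAt : ∀ n k (p : Fin (suc n)) {F} → Extensional F →
    sumFuns K (suc n) k F ≈ sum (λ j → sumFuns K n k (λ g → F (insertAt g p j)))
  sumFuns-insertAt n k zero {F} ext = begin
    sumFuns K (suc n) k F                        ≡⟨ sumFuns-suc n k F ⟩
    sum (λ j → sumFuns K n k (F ∘ (j ∷ᶠ_)))       ≈⟨ sum-cong-≋ (λ j → sumFuns-cong n k (λ g → ext (∷≗insertAt-zero j g))) ⟩
    sum (λ j → sumFuns K n k (λ g → F (insertAt g zero j))) ∎
    where
    ∷≗insertAt-zero : ∀ j (g : Fin n → Fin k) → j ∷ᶠ g ≗ insertAt g zero j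
    ∷≗insertAt-zero j g zero = refl
    ∷≗insertAt-zero j g (suc y) = refl
  sumFuns-insertAt (suc n) k (suc p) {F} ext = begin
    sumFuns K (suc (suc n)) k F
      ≡⟨ sumFuns-suc (suc n) k F ⟩
    sum (λ a → sumFuns K (suc n) k (F ∘ (a ∷ᶠ_)))
      ≈⟨ sum-cong-≋ (λ a → sumFuns-insertAt n k p (ext ∘ ∷-cong a)) ⟩
    sum (λ a → sum (λ j → sumFuns K n k (λ g → F (a ∷ᶠ insertAt g p j))))
      ≈⟨ ∑-comm (λ a j → sumFuns K n k (λ g → F (a ∷ᶠ insertAt g p j))) ⟩
    sum (λ j → sum (λ a → sumFuns K n k (λ g → F (a ∷ᶠ insertAt g p j))))
      ≈⟨ sum-cong-≋ (λ j → sum-cong-≋ (λ a → sumFuns-cong n k (λ g → ext (∷-insertAt a g j)))) ⟩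
    sum (λ j → sum (λ a → sumFuns K n k (λ g → F (insertAt (a ∷ᶠ g) (suc p) j))))
      ≈⟨ sum-cong-≋ (λ j → ≈-reflexive (sumFuns-suc n k (λ h → F (insertAt h (suc p) j)))) ⟨
    sum (λ j → sumFuns K (suc n) k (λ h → F (insertAt h (suc p) j))) ∎
    where
    ∷-cong : ∀ a {g h : Fin (suc n) → Fin k} → g ≗ h → a ∷ᶠ g ≗ a ∷ᶠ h
    ∷-cong a g≗h zero = refl
    ∷-cong a g≗h (suc y) = g≗h y
    ∷-insertAt : ∀ a (g : Fin n → Fin k) j → a ∷ᶠ insertAt g p j ≗ insertAt (a ∷ᶠ g) (suc p) j
    ∷-insertAt a g j zero = refl
    ∷-insertAt a g j (suc y) = refl

  -- Expand the sum at the position p that π sends to 0 and recurse on π with p removed.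
  sumFuns-∘-permutation : ∀ n k (π : Permutation′ n) {F} → Extensional F →
    sumFuns K n k (λ f → F (f ∘ (π ⟨$⟩ʳ_))) ≈ sumFuns K n k F
  sumFuns-∘-permutation zero k π ext = ext (λ ())
  sumFuns-∘-permutation (suc n) k π {F} ext = begin
    sumFuns K (suc n) k (λ f → F (f ∘ (π ⟨$⟩ʳ_)))
      ≡⟨ sumFuns-suc n k (λ f → F (f ∘ (π ⟨$⟩ʳ_))) ⟩
    sum (λ j → sumFuns K n k (λ h → F ((j ∷ᶠ h) ∘ (π ⟨$⟩ʳ_))))
      ≈⟨ sum-cong-≋ (λ j → sumFuns-cong n k (λ h → ext (∷-∘-permutation π j h))) ⟩
    sum (λ j → sumFuns K n k (λ h → F (insertAt (h ∘ (σ ⟨$⟩ʳ_)) p j)))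
      ≈⟨ sum-cong-≋ (λ j → sumFuns-∘-permutation n k σ (λ g≗h → ext (insertAt-cong g≗h p j))) ⟩
    sum (λ j → sumFuns K n k (λ h → F (insertAt h p j)))
      ≈⟨ sumFuns-insertAt n k p ext ⟨
    sumFuns K (suc n) k F ∎
    where
    p = π ⟨$⟩ˡ zero
    σ = remove p π

  Ψcoeff-∘-permutation : ∀ {n} {X Y : Set} (ζ : X → Carrier) (ζ′ : Y → Carrier)
    (restr : List (Fin n) → X) (restr′ : List (Fin n) → Y) (π : Permutation′ n) →
    (∀ {k} (f : Fin n → Fin k) j → ζ (restr (block f j)) ≡ ζ′ (restr′ (block (f ∘ (π ⟨$⟩ʳ_)) j))) →
    ∀ α → Ψcoeff K ζ restr α ≈ Ψcoeff K ζ′ restr′ α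
  Ψcoeff-∘-permutation {n} ζ ζ′ restr restr′ π ζ-block≡′ (α , _) = begin
    sumFuns K n k (summand ζ restr)                           ≈⟨ sumFuns-cong n k (≈-reflexive ∘ summand≡) ⟩
    sumFuns K n k (λ f → summand ζ′ restr′ (f ∘ (π ⟨$⟩ʳ_)))   ≈⟨ sumFuns-∘-permutation n k π summand-extensional ⟩
    sumFuns K n k (summand ζ′ restr′)                         ∎
    where
    k = length α
    summand : ∀ {X : Set} → (X → Carrier) → (List (Fin n) → X) → (Fin n → Fin k) → Carrier
    summand ζ restr f = if hasSizes α f then prodFin K k (λ j → ζ (restr (block f j))) else 0#
    summand≡ : ∀ f → summand ζ restr f ≡ summand ζ′ restr′ (f ∘ (π ⟨$⟩ʳ_))
    summand≡ f = cong₂ (λ b x → if b then x else 0#) (sym (hasSizes-∘-permutation α π f))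
      (foldr-cong (λ j acc → cong (_* acc) (ζ-block≡′ f j)) refl (allFin k))
    summand-extensional : Extensional (summand ζ′ restr′)
    summand-extensional f≗g = ≈-reflexive (cong₂ (λ b x → if b then x else 0#) (hasSizes-cong α f≗g)
      (foldr-cong (λ j acc → cong (λ B → ζ′ (restr′ B) * acc) (block-cong f≗g j)) refl (allFin k)))

-- Characters

ζPerm≡ζPoset : ∀ {c ℓ} (K : CommutativeRing c ℓ) {γ w} → Standard γ → Standard w →
  ζPerm K γ w ≡ ζPoset K (wordMatrix γ) (wordMatrix w)
ζPerm≡ζPoset K {γ} {w} std-γ std-w = sym (begin
  prodL K (map isγᴾ (factorsPoset (length (wordMatrix w)) (wordMatrix w)))
    ≡⟨ cong (λ n → prodL K (map isγᴾ (factorsPoset n (wordMatrix w)))) (length-wordMatrix w) ⟩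
  prodL K (map isγᴾ (factorsPoset (length w) (wordMatrix w)))
    ≡⟨ cong (prodL K ∘ map isγᴾ) (factorsPoset-wordMatrix (length w) w) ⟩
  prodL K (map isγᴾ (map wordMatrix (factorsWord (length w) w)))
    ≡⟨ cong (prodL K) (map-∘ (factorsWord (length w) w)) ⟨
  prodL K (map (isγᴾ ∘ wordMatrix) (factorsWord (length w) w))
    ≡⟨ cong (prodL K) (map-cong-local (All.map isγᴾ∘wordMatrix≡isγ (factorsWord-Standard (length w) std-w))) ⟩
  prodL K (map isγ (factorsWord (length w) w)) ∎)
  where
  open CommutativeRing K using (1#; 0#)
  open ≡-Reasoning
  isγ : List ℕ → _
  isγ u = if ⌊ ≡-dec _≟ⁿ_ u γ ⌋ then 1# else 0#
  isγᴾ : List (List Bool) → _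
  isγᴾ M = if ⌊ ≡-dec (≡-dec _≟ᵇ_) M (wordMatrix γ) ⌋ then 1# else 0#
  isγᴾ∘wordMatrix≡isγ : ∀ {u} → Standard u → isγᴾ (wordMatrix u) ≡ isγ u
  isγᴾ∘wordMatrix≡isγ {u} std-u = cong (λ b → if b then 1# else 0#)
    (trans (isYes≗does M≟) (trans (does-⇔ M≡⇔u≡ M≟ u≟) (sym (isYes≗does u≟))))
    where
    M≟ = ≡-dec (≡-dec _≟ᵇ_) (wordMatrix u) (wordMatrix γ)
    u≟ = ≡-dec _≟ⁿ_ u γ
    M≡⇔u≡ = mk⇔ (wordMatrix-injective std-u std-γ) (cong wordMatrix)

ΨPerm≈ΨPoset-posetOf : ∀ {c ℓ} (K : CommutativeRing c ℓ) {m n} (γ : Permutation′ m) (β : Permutation′ n) α →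
  CommutativeRing._≈_ K (ΨPerm K γ β α) (ΨPoset K (posetOf γ) (posetOf β) α)
ΨPerm≈ΨPoset-posetOf K {m} γ β = Ψcoeff-∘-permutation K
  (ζPerm K (word γ)) (ζPoset K (posetMatrix (posetOf γ))) (restrictWord β) (restrictPoset (posetOf β)) β ζ-block≡
  where
  open ≡-Reasoning
  ζ-block≡ : ∀ {k} (f : Fin _ → Fin k) j →
    ζPerm K (word γ) (restrictWord β (block f j)) ≡
    ζPoset K (posetMatrix (posetOf γ)) (restrictPoset (posetOf β) (block (f ∘ (β ⟨$⟩ʳ_)) j))
  ζ-block≡ f j = begin
    ζPerm K (word γ) (restrictWord β (block f j))
      ≡⟨ cong (ζPerm K (word γ)) (restrictWord-block β f j) ⟩
    ζPerm K (word γ) (st (valuesAt β B))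
      ≡⟨ ζPerm≡ζPoset K (word-Standard γ) (valuesAt β B , valuesAt-Unique β (UP.filter⁺ (λ x → f (β ⟨$⟩ʳ x) ≟ᶠ j) (UP.allFin⁺ _)) , refl) ⟩
    ζPoset K (wordMatrix (word γ)) (wordMatrix (st (valuesAt β B)))
      ≡⟨ cong₂ (ζPoset K) (sym (relMatrix-posetOf γ (allFin m) (allFin-increasing m)))
           (trans (wordMatrix-st (valuesAt β B)) (sym (relMatrix-posetOf β B (block-increasing (f ∘ (β ⟨$⟩ʳ_)) j)))) ⟩
    ζPoset K (posetMatrix (posetOf γ)) (restrictPoset (posetOf β) B) ∎
    where B = block (f ∘ (β ⟨$⟩ʳ_)) j

lemma1p5 : ∀ {c ℓ} (K : CommutativeRing c ℓ) → IsField K →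
    ∀ {m} (γ : Permutation′ m) → 0 < m → IndecomposablePerm γ →
    IndecomposablePoset (posetOf γ) ×
    (∀ {n} (β : Permutation′ n) (α : Composition n) →
      CommutativeRing._≈_ K (ΨPerm K γ β α) (ΨPoset K (posetOf γ) (posetOf β) α))
lemma1p5 K _ γ _ indecomposable = posetOf-indecomposable γ indecomposable , ΨPerm≈ΨPoset-posetOf K γ
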